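{- Let $(W,S)$ be a simply-laced triangle-free Coxeter system and let ${\boldsymbol{\alpha}}$ be a link of rank $r\ge2$. Then for every $1\le i\le r-1$ there exists ${\boldsymbol{\sigma}}\in[{\boldsymbol{\alpha}}]$ such that $\llbracket 2i-1,2i+1\rrbracket\in\operatorname{bs}({\boldsymbol{\sigma}})$ and $\llbracket 2i+1,2i+3\rrbracket\in\operatorname{bs}({\boldsymbol{\sigma}})$.
   Context: A Coxeter system $(W,S)$: finite $S$, $W=\langle S\mid (st)^{m(s,t)}=e\rangle$, $m(s,s)=1$, $m(s,t)\in\{2,3,\dots,\infty\}$ for $s\ne t$; simply laced: $m(s,t)\le3$; Coxeter graph $\Gamma$ on $S$ with edge $\{s,t\}$ iff $m(s,t)\ge3$; triangle free: no three-cycles in $\Gamma$. Reduced expression: minimal-length word for its element. Braid move: replace consecutive $sts$ by $tst$ with $m(s,t)=3$; braid class $[{\boldsymbol{\alpha}}]$: reduced expressions reachable from ${\boldsymbol{\alpha}}$ by braid moves. For ${\boldsymbol{\alpha}}=s_{x_1}\cdots s_{x_m}$, the position interval $\llbracket i,i+2\rrbracket$ is a braid shadow of ${\boldsymbol{\alpha}}$ if $s_{x_i}=s_{x_{i+2}}$ and $m(s_{x_i},s_{x_{i+1}})=3$; $\operatorname{bs}({\boldsymbol{\alpha}})$ is the set of braid shadows of ${\boldsymbol{\alpha}}$, $\operatorname{bs}([{\boldsymbol{\alpha}}])$ the union over the braid class, and $\operatorname{rank}({\boldsymbol{\alpha}})=|\operatorname{bs}([{\boldsymbol{\alpha}}])|$.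 A reduced expression with $m\ge1$ letters is a link if $m=1$ or $m$ is odd and $\operatorname{bs}([{\boldsymbol{\alpha}}])=\{\llbracket1,3\rrbracket,\dots,\llbracket m-2,m\rrbracket\}$. -}

module Defs where

open import Data.Nat using (ℕ; zero; suc; _+_; _*_; _∸_; _≤_)
open import Data.Fin using (Fin)
open import Data.List using (List; []; _∷_; _++_; length)
open import Data.List.Membership.Propositional using (_∈_)
open import Data.List.Relation.Unary.Unique.Propositional using (Unique)
open import Data.Product using (Σ; ∃; _×_; _,_)
open import Data.Sum using (_⊎_)
open import Relation.Nullary using (¬_)
open import Relation.Binary.PropositionalEquality using (_≡_; _≢_)
open import Relation.Binary.Construct.Closure.ReflexiveTransitive using (Star)

record SimplyLacedCoxeter (n : ℕ) : Set where
  field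
    m      : Fin n → Fin n → ℕ
    m-diag : ∀ s → m s s ≡ 1
    m-sym  : ∀ s t → m s t ≡ m t s
    m-off  : ∀ s t → s ≢ t → (m s t ≡ 2) ⊎ (m s t ≡ 3)

module _ {n : ℕ} (C : SimplyLacedCoxeter n) where
  open SimplyLacedCoxeter C

  -- Coxeter graph: edge {s,t} iff m(s,t) ≥ 3, i.e. m(s,t) = 3 here.
  Edge : Fin n → Fin n → Set
  Edge s t = m s t ≡ 3

  TriangleFree : Set
  TriangleFree = ∀ s t u → ¬ (Edge s t × Edge t u × Edge u s)

  Word : Set
  Word = List (Fin n)

  stPow : Fin n → Fin n → ℕ → Word
  stPow s t zero    = []
  stPow s t (suc k) = s ∷ t ∷ stPow s t k

  -- equality in W = ⟨ S ∣ (st)^{m(s,t)} = e ⟩ : the congruence on words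
  -- generated by the defining relators (since every generator is an
  -- involution, the monoid congruence presents the group W).
  data _≈W_ : Word → Word → Set where
    ≈refl  : ∀ {u} → u ≈W u
    ≈sym   : ∀ {u v} → u ≈W v → v ≈W u
    ≈trans : ∀ {u v w} → u ≈W v → v ≈W w → u ≈W w
    ≈rel   : ∀ u v s t → (u ++ stPow s t (m s t) ++ v) ≈W (u ++ v)

  Reduced : Word → Set
  Reduced α = ∀ β → β ≈W α → length α ≤ length β

  data BraidMove : Word → Word → Set where
    braid : ∀ u v s t → m s t ≡ 3 →
            BraidMove (u ++ s ∷ t ∷ s ∷ v) (u ++ t ∷ s ∷ t ∷ v)

  InBraidClass : Word → Word → Set
  InBraidClass σ α = Star BraidMove α σ

  -- ⟦i, i+2⟧ ∈ bs(α)  (positions 1-indexed): x_i = x_{i+2}, m(x_i, x_{i+1}) = 3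
  BS : Word → ℕ → Set
  BS α i = Σ Word λ u → Σ Word λ v → Σ (Fin n) λ s → Σ (Fin n) λ t →
           (α ≡ u ++ s ∷ t ∷ s ∷ v) × (suc (length u) ≡ i) × (m s t ≡ 3)

  BSClass : Word → ℕ → Set
  BSClass α i = Σ Word λ σ → InBraidClass σ α × BS σ i

  Odd : ℕ → Set
  Odd k = Σ ℕ λ j → k ≡ 2 * j + 1

  Link : Word → Set
  Link α = Reduced α × 1 ≤ length α ×
           ((length α ≡ 1) ⊎
            (Odd (length α) ×
             (∀ i → (BSClass α i → Odd i × i + 2 ≤ length α) ×
                    (Odd i × i + 2 ≤ length α → BSClass α i))))

  -- rank(α) = |bs([α])| : the set of braid shadows of [α] (each ⟦i,i+2⟧
  -- identified with its start i) has exactly r elements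
  HasRank : Word → ℕ → Set
  HasRank α r = Σ (List ℕ) λ xs → Unique xs ×
                (∀ i → (i ∈ xs → BSClass α i) × (BSClass α i → i ∈ xs)) ×
                length xs ≡ r

-- Fix k and suppose that [α] has the braid shadows ⟦k+1,k+3⟧ (in σ) and ⟦k+3,k+5⟧ (in τ) but
-- none at ⟦k,k+2⟧ or ⟦k+2,k+4⟧. Walk along braid moves from σ to τ, keeping a word ν of [α] that
-- has the shadow ⟦k+1,k+3⟧ and agrees with the current word from position k+2 on. A move before
-- position k+1 leaves that common tail alone, a move at k+1 yields a new ν, a move beyond k+3 is
-- replayed in ν, and a move at k+3 hands its shadow ⟦k+3,k+5⟧ over to ν, which then has both.
-- In a link all shadows of [α] are odd, so there are none at the even positions 2i − 2 and 2i;
-- and bs([α]) ⊆ {1, 3, …, ℓ(α) − 2} gives ℓ(α) ≥ 2 rank + 1, so 2i − 1 and 2i + 1 are shadows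
-- of [α] for i < rank.
module Submission where

open import Defs
open import Data.Nat using (ℕ; zero; suc; _+_; _*_; _∸_; _≤_; _<_; z≤n; s≤s; s≤s⁻¹)
open import Data.Nat.Properties
open import Data.Product using (Σ; _×_; _,_; proj₁; proj₂)
open import Function using (_∘_)
open import Data.Sum using (_⊎_; inj₁; inj₂)
open import Data.Empty using (⊥-elim)
open import Data.Fin using (Fin)
open import Data.List using (List; []; _∷_; _++_; length; drop; applyUpTo)
open import Data.List.Properties
  using (length-++; length-++-sucʳ; length-drop; length-applyUpTo; ++-assoc; ∷-injective)
open import Data.List.Membership.Propositional using (_∈_)
open import Data.List.Membership.Propositional.Properties
  using (∈-∃++; ∈-++⁻; ∈-++⁺ˡ; ∈-++⁺ʳ; ∈-applyUpTo⁺)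
open import Data.List.Relation.Binary.Subset.Propositional using (_⊆_)
open import Data.List.Relation.Unary.Any using (here; there)
import Data.List.Relation.Unary.All as All
open import Data.List.Relation.Unary.AllPairs using ([]; _∷_)
open import Data.List.Relation.Unary.Unique.Propositional using (Unique)
open import Relation.Nullary using (¬_; contradiction)
open import Relation.Binary.PropositionalEquality
open import Relation.Binary.Construct.Closure.ReflexiveTransitive using (Star; ε; _◅_; _◅◅_; reverse)

module _ {a} {A : Set a} where

  drop-++-≤ : ∀ k (u v : List A) → k ≤ length u → drop k (u ++ v) ≡ drop k u ++ v
  drop-++-≤ zero    u       v _         = refl
  drop-++-≤ (suc k) (_ ∷ u) v (s≤s k≤u) = drop-++-≤ k u v k≤u

  drop-++-∷ : ∀ (u : List A) x v → drop (suc (length u)) (u ++ x ∷ v) ≡ v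
  drop-++-∷ []      x v = refl
  drop-++-∷ (_ ∷ u) x v = drop-++-∷ u x v

  drop-++-replace : ∀ k (u z z′ v : List A) → length z ≡ length z′ → length u + length z ≤ k →
                    drop k (u ++ z ++ v) ≡ drop k (u ++ z′ ++ v)
  drop-++-replace k       []      []      []       v _  _         = refl
  drop-++-replace k       []      []      (_ ∷ _)  v () _
  drop-++-replace k       []      (_ ∷ _) []       v () _
  drop-++-replace (suc k) []      (_ ∷ z) (_ ∷ z′) v eq (s≤s le) =
    drop-++-replace k [] z z′ v (suc-injective eq) le
  drop-++-replace (suc k) (_ ∷ u) z       z′       v eq (s≤s le) = drop-++-replace k u z z′ v eq le

  Unique-⊆⇒length-≤ : ∀ {xs ys : List A} → Unique xs → xs ⊆ ys → length xs ≤ length ys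
  Unique-⊆⇒length-≤ {[]}     _             _     = z≤n
  Unique-⊆⇒length-≤ {x ∷ xs} (x∉xs ∷ uxs) xs⊆ys with ∈-∃++ (xs⊆ys (here refl))
  ... | ys₁ , ys₂ , refl = ≤-trans (s≤s (Unique-⊆⇒length-≤ uxs xs⊆ys₁ys₂))
                                   (≤-reflexive (sym (length-++-sucʳ ys₁ x ys₂)))
    where
    xs⊆ys₁ys₂ : xs ⊆ ys₁ ++ ys₂
    xs⊆ys₁ys₂ {z} z∈xs with ∈-++⁻ ys₁ (xs⊆ys (there z∈xs))
    ... | inj₁ z∈ys₁          = ∈-++⁺ˡ z∈ys₁
    ... | inj₂ (here z≡x)     = contradiction (sym z≡x) (All.lookup x∉xs z∈xs)
    ... | inj₂ (there z∈ys₂) = ∈-++⁺ʳ ys₁ z∈ys₂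

-- Position of a braid move relative to the shadow ⟦k+1,k+3⟧; p counts the letters before the move.
data Placement (p k : ℕ) : Set where
  before : p + 3 ≤ suc k → Placement p k
  at     : p ≡ k → Placement p k
  next   : p ≡ 2 + k → Placement p k
  beyond : 3 + k ≤ p → Placement p k

placement : ∀ p k → p ≢ suc k → suc p ≢ k → Placement p k
placement zero                zero                _  _  = at refl
placement zero                (suc zero)          _  ne = ⊥-elim (ne refl)
placement zero                (suc (suc k))       _  _  = before (s≤s (s≤s (s≤s z≤n)))
placement (suc zero)          zero                ne _  = ⊥-elim (ne refl)
placement (suc (suc zero))    zero                _  _  = next refl
placement (suc (suc (suc p))) zero                _  _  = beyond (s≤s (s≤s (s≤s z≤n)))
placement (suc p)             (suc k)             ne ne′ =
  shift (placement p k (ne ∘ cong suc) (ne′ ∘ cong suc))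
  where
  shift : Placement p k → Placement (suc p) (suc k)
  shift (before le) = before (s≤s le)
  shift (at eq)     = at (cong suc eq)
  shift (next eq)   = next (cong suc eq)
  shift (beyond le) = beyond (s≤s le)

1+2j+2≡1+2[1+j] : ∀ j → suc (2 * j) + 2 ≡ suc (2 * suc j)
1+2j+2≡1+2[1+j] j = cong suc (trans (+-comm (2 * j) 2) (sym (*-suc 2 j)))

<⇒odd-window : ∀ {j J} → j < J → suc (2 * j) + 2 ≤ suc (2 * J)
<⇒odd-window {j} j<J = ≤-trans (≤-reflexive (1+2j+2≡1+2[1+j] j)) (s≤s (*-monoʳ-≤ 2 j<J))

odd-window⇒< : ∀ {j J} → suc (2 * j) + 2 ≤ suc (2 * J) → j < J
odd-window⇒< {j} le =
  *-cancelˡ-≤ 2 (s≤s⁻¹ (≤-trans (≤-reflexive (sym (1+2j+2≡1+2[1+j] j))) le))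

3+2j≡2[1+j]+1 : ∀ j → 3 + 2 * j ≡ 2 * suc j + 1
3+2j≡2[1+j]+1 j = sym (trans (cong (_+ 1) (*-suc 2 j)) (cong (2 +_) (+-comm (2 * j) 1)))

module _ {n} (C : SimplyLacedCoxeter n) where
  open SimplyLacedCoxeter C

  BraidMove-sym : ∀ {w w′} → BraidMove C w w′ → BraidMove C w′ w
  BraidMove-sym (braid u v s t e) = braid u v t s (trans (m-sym t s) e)

  BraidMove-++ : ∀ a {w w′} → BraidMove C w w′ → BraidMove C (a ++ w) (a ++ w′)
  BraidMove-++ a (braid u v s t e) =
    subst₂ (BraidMove C) (++-assoc a u _) (++-assoc a u _) (braid (a ++ u) v s t e)

  BraidMove-length : ∀ {w w′} → BraidMove C w w′ → length w′ ≡ length w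
  BraidMove-length (braid u v s t e) = trans (length-++ u) (sym (length-++ u))

  InBraidClass-length : ∀ {σ α} → InBraidClass C σ α → length σ ≡ length α
  InBraidClass-length ε          = refl
  InBraidClass-length (mv ◅ mvs) = trans (InBraidClass-length mvs) (BraidMove-length mv)

  BS-length : ∀ {w p} → BS C w p → 3 ≤ length w
  BS-length (u , v , _ , _ , refl , _ , _) =
    ≤-trans (s≤s (s≤s (s≤s z≤n)))
            (≤-trans (m≤n+m _ (length u)) (≤-reflexive (sym (length-++ u))))

  BSClass-length : ∀ {α p} → BSClass C α p → 3 ≤ length α
  BSClass-length (σ , σ∈[α] , bs) = subst (3 ≤_) (InBraidClass-length σ∈[α]) (BS-length bs)

  BS-∷ : ∀ {x w q} → BS C w (suc q) → BS C (x ∷ w) (suc (suc q))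
  BS-∷ {x} (u , v , s , t , eq , len , e) = x ∷ u , v , s , t , cong (x ∷_) eq , cong suc len , e

  BS-uncons : ∀ {x w q} → BS C (x ∷ w) (suc (suc q)) → BS C w (suc q)
  BS-uncons ([]    , v , s , t , eq , () , e)
  BS-uncons (_ ∷ u , v , s , t , eq , len , e) =
    u , v , s , t , proj₂ (∷-injective eq) , suc-injective len , e

  BS-++ : ∀ a {w q} → BS C w (suc q) → BS C (a ++ w) (suc (q + length a))
  BS-++ a (u , v , s , t , refl , refl , e) =
    a ++ u , v , s , t , sym (++-assoc a u _) ,
    cong suc (trans (length-++ a) (+-comm (length a) (length u))) , e

  BS-drop : ∀ k {w q} → BS C w (suc (q + k)) → BS C (drop k w) (suc q)
  BS-drop zero    {w}     {q} bs = subst (λ i → BS C w (suc i)) (+-identityʳ q) bs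
  BS-drop (suc k) {[]}        bs = contradiction (BS-length bs) λ ()
  BS-drop (suc k) {x ∷ w} {q} bs =
    BS-drop k (BS-uncons (subst (λ i → BS C (x ∷ w) (suc i)) (+-suc q k) bs))

  BS₁-++ : ∀ z {r r′} → 3 ≤ length z → BS C (z ++ r) 1 → BS C (z ++ r′) 1
  BS₁-++ (_ ∷ _ ∷ _ ∷ z) _ ([] , v , s , t , refl , refl , e) = [] , z ++ _ , s , t , refl , refl , e
  BS₁-++ (_ ∷ _ ∷ _ ∷ z) _ (_ ∷ _ , _ , _ , _ , _ , () , _)
  BS₁-++ (_ ∷ [])         (s≤s ())         _
  BS₁-++ (_ ∷ _ ∷ [])     (s≤s (s≤s ()))   _

  module _ (α : Word C) where

    -- d is the part after position k+1 of a word of [α] with the shadow ⟦k+1,k+3⟧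
    ShadowTail : ℕ → Word C → Set
    ShadowTail k d = Σ (Word C) λ a → Σ (Fin n) λ x →
                     length a ≡ k × BS C (x ∷ d) 1 × InBraidClass C (a ++ x ∷ d) α

    AdjacentShadows : ℕ → Set
    AdjacentShadows k = Σ (Word C) λ ρ → InBraidClass C ρ α × BS C ρ (suc k) × BS C ρ (3 + k)

    BS⇒ShadowTail : ∀ {k w} → InBraidClass C w α → BS C w (suc k) → ShadowTail k (drop (suc k) w)
    BS⇒ShadowTail w∈[α] (u , y , s , t , refl , refl , e)
      rewrite drop-++-∷ u s (t ∷ s ∷ y) = u , s , refl , ([] , y , s , t , refl , refl , e) , w∈[α]

    ShadowTail-BS⇒AdjacentShadows : ∀ {k d} → ShadowTail k d → BS C d 2 → AdjacentShadows k
    ShadowTail-BS⇒AdjacentShadows {d = d} (a , x , refl , sh , ν∈[α]) bs =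
      a ++ x ∷ d , ν∈[α] , BS-++ a sh , BS-++ a (BS-∷ bs)

    ShadowTail-braid-beyond : ∀ {k} u {y s t} → 3 + k ≤ length u → m s t ≡ 3 →
                              ShadowTail k (drop (suc k) (u ++ s ∷ t ∷ s ∷ y)) →
                              ShadowTail k (drop (suc k) (u ++ t ∷ s ∷ t ∷ y))
    ShadowTail-braid-beyond {k} u {y} {s} {t} le e tail =
      subst (ShadowTail k) (sym (drop-++-≤ (suc k) u _ k<u))
            (replay (subst (ShadowTail k) (drop-++-≤ (suc k) u _ k<u) tail))
      where
      d : Word C
      d = drop (suc k) u
      k<u : suc k ≤ length u
      k<u = m+n≤o⇒n≤o 2 le
      2≤d : 2 ≤ length d
      2≤d = subst (2 ≤_) (sym (length-drop (suc k) u)) (m+n≤o⇒m≤o∸n 2 le)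
      replay : ShadowTail k (d ++ s ∷ t ∷ s ∷ y) → ShadowTail k (d ++ t ∷ s ∷ t ∷ y)
      replay (a , x , la , sh , ν∈[α]) =
        a , x , la , BS₁-++ (x ∷ d) (s≤s 2≤d) sh ,
        ν∈[α] ◅◅ BraidMove-++ a (braid (x ∷ d) y s t e) ◅ ε

    module _ {k} (no-shadow-k : ¬ BSClass C α k) (no-shadow-k+2 : ¬ BSClass C α (2 + k)) where

      ShadowTail-step : ∀ {v v′} → InBraidClass C v α → BraidMove C v v′ →
                        ShadowTail k (drop (suc k) v) →
                        AdjacentShadows k ⊎ ShadowTail k (drop (suc k) v′)
      ShadowTail-step v∈[α] mv@(braid u y s t e) tail =
        continue (placement (length u) k (no-shadow-k+2 ∘ inClass ∘ cong suc) (no-shadow-k ∘ inClass))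
        where
        shadowAt : ∀ {p} → suc (length u) ≡ p → BS C (u ++ s ∷ t ∷ s ∷ y) p
        shadowAt eq = subst (BS C _) eq (u , y , s , t , refl , refl , e)
        inClass : ∀ {p} → suc (length u) ≡ p → BSClass C α p
        inClass eq = _ , v∈[α] , shadowAt eq
        continue : Placement (length u) k →
                   AdjacentShadows k ⊎ ShadowTail k (drop (suc k) (u ++ t ∷ s ∷ t ∷ y))
        continue (before le) = inj₂ (subst (ShadowTail k) (drop-++-replace (suc k) u _ _ y refl le) tail)
        continue (at eq)     =
          inj₂ (BS⇒ShadowTail (v∈[α] ◅◅ mv ◅ ε)
                              (u , y , t , s , refl , cong suc eq , trans (m-sym t s) e))
        continue (next eq)   =
          inj₁ (ShadowTail-BS⇒AdjacentShadows tail (BS-drop (suc k) (shadowAt (cong suc eq))))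
        continue (beyond le) = inj₂ (ShadowTail-braid-beyond u le e tail)

      ShadowTail-walk : ∀ {v τ} → InBraidClass C v α → Star (BraidMove C) v τ →
                        BS C (drop (suc k) τ) 2 → ShadowTail k (drop (suc k) v) → AdjacentShadows k
      ShadowTail-walk v∈[α] ε          bs tail = ShadowTail-BS⇒AdjacentShadows tail bs
      ShadowTail-walk v∈[α] (mv ◅ mvs) bs tail with ShadowTail-step v∈[α] mv tail
      ... | inj₁ adjacent = adjacent
      ... | inj₂ tail′    = ShadowTail-walk (v∈[α] ◅◅ mv ◅ ε) mvs bs tail′

      BSClass⇒AdjacentShadows : BSClass C α (suc k) → BSClass C α (3 + k) → AdjacentShadows k
      BSClass⇒AdjacentShadows (σ , σ∈[α] , bsσ) (τ , τ∈[α] , bsτ) =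
        ShadowTail-walk σ∈[α] (reverse BraidMove-sym σ∈[α] ◅◅ τ∈[α]) (BS-drop (suc k) bsτ)
                        (BS⇒ShadowTail σ∈[α] bsσ)

  rank-≤ : ∀ {α r} ps → HasRank C α r → (∀ p → BSClass C α p → p ∈ ps) → r ≤ length ps
  rank-≤ ps (xs , xs-unique , xs⇔shadows , refl) shadows∈ps =
    Unique-⊆⇒length-≤ xs-unique λ {p} p∈xs → shadows∈ps p (proj₁ (xs⇔shadows p) p∈xs)

  ShadowsOddBelow : Word C → ℕ → Set
  ShadowsOddBelow α J = (∀ {j} → j < J → BSClass C α (suc (2 * j))) ×
                        (∀ {p} → BSClass C α p → Σ ℕ λ j → j < J × p ≡ suc (2 * j))

  Link⇒ShadowsOddBelow : ∀ {α} → Link C α → Σ ℕ (ShadowsOddBelow α)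
  Link⇒ShadowsOddBelow (_ , _ , inj₁ ℓ≡1) =
    0 , (λ ()) , λ bs → contradiction (subst (3 ≤_) ℓ≡1 (BSClass-length bs)) λ { (s≤s ()) }
  Link⇒ShadowsOddBelow {α} (_ , _ , inj₂ ((J , ℓ≡2J+1) , shadows⇔)) = J , odd-shadow , shadow-odd
    where
    ℓ≡1+2J : length α ≡ suc (2 * J)
    ℓ≡1+2J = trans ℓ≡2J+1 (+-comm (2 * J) 1)
    odd-shadow : ∀ {j} → j < J → BSClass C α (suc (2 * j))
    odd-shadow {j} j<J =
      proj₂ (shadows⇔ _) ((j , +-comm 1 (2 * j)) , subst (_ ≤_) (sym ℓ≡1+2J) (<⇒odd-window j<J))
    shadow-odd : ∀ {p} → BSClass C α p → Σ ℕ λ j → j < J × p ≡ suc (2 * j)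
    shadow-odd {p} bs with proj₁ (shadows⇔ p) bs
    ... | (j , refl) , window =
      j , odd-window⇒< (subst₂ _≤_ (cong (_+ 2) (+-comm (2 * j) 1)) ℓ≡1+2J window) ,
      +-comm (2 * j) 1

  ShadowsOddBelow⇒rank-≤ : ∀ {α r J} → HasRank C α r → ShadowsOddBelow α J → r ≤ J
  ShadowsOddBelow⇒rank-≤ {α} {r} {J} rank (_ , shadow-odd) =
    subst (r ≤_) (length-applyUpTo _ J) (rank-≤ _ rank shadow∈)
    where
    shadow∈ : ∀ p → BSClass C α p → p ∈ applyUpTo (λ j → suc (2 * j)) J
    shadow∈ p bs with shadow-odd bs
    ... | j , j<J , refl = ∈-applyUpTo⁺ _ j<J

  ShadowsOddBelow⇒AdjacentShadows : ∀ {α J} → ShadowsOddBelow α J →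
                                    ∀ c → suc c < J → AdjacentShadows α (2 * c)
  ShadowsOddBelow⇒AdjacentShadows {α} (odd-shadow , shadow-odd) c c+1<J =
    BSClass⇒AdjacentShadows α
      (no-even-shadow c) (subst (λ p → ¬ BSClass C α p) (*-suc 2 c) (no-even-shadow (suc c)))
      (odd-shadow (≤-trans (n≤1+n (suc c)) c+1<J))
      (subst (BSClass C α) (cong suc (*-suc 2 c)) (odd-shadow c+1<J))
    where
    no-even-shadow : ∀ j → ¬ BSClass C α (2 * j)
    no-even-shadow j bs with shadow-odd bs
    ... | j′ , _ , 2j≡1+2j′ = even≢odd j j′ 2j≡1+2j′

lemma5p4 : ∀ {n} (C : SimplyLacedCoxeter n) → TriangleFree C →
           ∀ (α : Word C) (r : ℕ) → Link C α → HasRank C α r → 2 ≤ r →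
           ∀ i → 1 ≤ i → i ≤ r ∸ 1 →
           Σ (Word C) λ σ → InBraidClass C σ α ×
             BS C σ (2 * i ∸ 1) × BS C σ (2 * i + 1)
lemma5p4 C _ α _ link rank (s≤s (s≤s _)) (suc c) _ (s≤s c≤r) =
  let J , shadows = Link⇒ShadowsOddBelow C link
      c+1<J = ≤-trans (s≤s (s≤s c≤r)) (ShadowsOddBelow⇒rank-≤ C rank shadows)
      ρ , ρ∈[α] , bs₁ , bs₃ = ShadowsOddBelow⇒AdjacentShadows C shadows c c+1<J
  in ρ , ρ∈[α] , subst (BS C ρ) (cong (_∸ 1) (sym (*-suc 2 c))) bs₁ ,
     subst (BS C ρ) (3+2j≡2[1+j]+1 c) bs₃
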